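{- For every prae-dilator $T$, the linear order $\operatorname{BH}(T)$ is a Bachmann-Howard fixed point of $T$, i.e. there is a function $\vartheta:T_{\operatorname{BH}(T)}\to\operatorname{BH}(T)$ such that for all $\sigma,\tau\in T_{\operatorname{BH}(T)}$: (i) if $\sigma<_{T_{\operatorname{BH}(T)}}\tau$ and $\operatorname{supp}^T_{\operatorname{BH}(T)}(\sigma)<^{\operatorname{fin}}_{\operatorname{BH}(T)}\vartheta(\tau)$, then $\vartheta(\sigma)<_{\operatorname{BH}(T)}\vartheta(\tau)$; and (ii) $\operatorname{supp}^T_{\operatorname{BH}(T)}(\sigma)<^{\operatorname{fin}}_{\operatorname{BH}(T)}\vartheta(\sigma)$.
   Context: Linear orders are considered with order embeddings as morphisms. For a set $X$ let $[X]^{<\omega}$ be the set of finite subsets of $X$, and $[f]^{<\omega}(a)=\{f(x)\mid x\in a\}$. A prae-dilator is an endofunctor $X\mapsto T_X$, $f\mapsto T_f$ on the category of linear orders with a natural transformation $\operatorname{supp}^T:T\Rightarrow[\cdot]^{<\omega}$ such that for every $X$ and $\sigma\in T_X$, $\sigma\in\operatorname{rng}(T_{\iota_\sigma})$ for the inclusion $\iota_\sigma:\operatorname{supp}^T_X(\sigma)\hookrightarrow X$. For a linear order $Z$ and finite $a,b\subseteq Z$, $a<^{\operatorname{fin}}_Z b$ iff every $s\in a$ has some $t\in b$ with $s<_Z t$; $\leq^{\operatorname{fin}}_Z$ analogously; singletons $\{s\}$ written $s$. $\vartheta_T(X)$ is the set of formal terms $\vartheta\sigma$, $\sigma\in T_X$.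 A Bachmann-Howard system is a triple $(X,\iota_X,L_X)$ with $X$ a linear order, $\iota_X:X\to\vartheta_T(X)$, $L_X:X\to\omega$, such that $L_{\vartheta_T(X)}\circ\iota_X=L_X$ where $L_{\vartheta_T(X)}(\vartheta\sigma)=\max\{L_X(x)\mid x\in\operatorname{supp}^T_X(\sigma)\}+1$ ($\max\emptyset=0$). The linear order on $\vartheta_T(X)$ is defined by recursion on $L_{\vartheta_T(X)}(\vartheta\sigma)+L_{\vartheta_T(X)}(\vartheta\tau)$: $\vartheta\sigma<\vartheta\tau$ iff (i) $\sigma<_{T_X}\tau$ and $[\iota_X]^{<\omega}(\operatorname{supp}^T_X(\sigma))<^{\operatorname{fin}}\vartheta\tau$, or (ii) $\tau<_{T_X}\sigma$ and $\vartheta\sigma\leq^{\operatorname{fin}}[\iota_X]^{<\omega}(\operatorname{supp}^T_X(\tau))$. Good means $\iota_X$ is an order embedding. For a good system, $\iota_{\vartheta_T(X)}(\vartheta\sigma):=\vartheta\,T_{\iota_X}(\sigma)$, and $(\vartheta_T(X),\iota_{\vartheta_T(X)},L_{\vartheta_T(X)})$ is again a good Bachmann-Howard system. $\operatorname{BH}(T)$: let $(X_0,\iota_{X_0},L_{X_0})=(\emptyset,\text{empty map},\text{empty map})$ and $(X_{n+1},\iota_{X_{n+1}},L_{X_{n+1}})=(\vartheta_T(X_n),\iota_{\vartheta_T(X_n)},L_{\vartheta_T(X_n)})$; all are good Bachmann-Howard systems. $\operatorname{BH}(T)$ is the direct limit of the system of linear orders $(X_n,\iota_{X_n}:X_n\to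 X_{n+1})_{n\in\omega}$. -}

module Defs where

open import Level using (0ℓ)
open import Function using (_∘_)
open import Data.Empty using (⊥; ⊥-elim)
open import Data.Nat using (ℕ; zero; suc; _+_; _⊔_; _≤_; z≤n; _≤′_; ≤′-refl; ≤′-step)
open import Data.Nat.Properties using (m≤m⊔n; m≤n⊔m; ⊔-lub; ≤⇒≤′; ≤-antisym; ≤-trans; ≤-reflexive)
open import Data.Product using (Σ; _×_; _,_; proj₁; proj₂)
open import Data.Sum using (_⊎_; inj₁; inj₂)
open import Data.List using (List; []; _∷_; map; foldr)
open import Data.List.Relation.Unary.All using (All)
open import Data.List.Relation.Unary.Any using (Any; here; there)
open import Relation.Binary using (Rel; StrictTotalOrder; IsStrictTotalOrder)
open import Relation.Binary.Morphism.Structures using (IsOrderHomomorphism)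
import Relation.Binary.Construct.On as On
open import Relation.Binary.PropositionalEquality using (_≡_; refl; sym; trans; cong)

LO : Set₁
LO = StrictTotalOrder 0ℓ 0ℓ 0ℓ

Car : LO → Set
Car = StrictTotalOrder.Carrier

Eq : (X : LO) → Rel (Car X) 0ℓ
Eq = StrictTotalOrder._≈_

Lt : (X : LO) → Rel (Car X) 0ℓ
Lt = StrictTotalOrder._<_

record Emb (X Y : LO) : Set where
  constructor emb
  field
    fun   : Car X → Car Y
    isEmb : IsOrderHomomorphism (Eq X) (Eq Y) (Lt X) (Lt Y) fun
open Emb public

idE : (X : LO) → Emb X X
idE X = emb (λ x → x) record { cong = λ p → p ; mono = λ p → p }

_∘E_ : {X Y Z : LO} → Emb Y Z → Emb X Y → Emb X Z
g ∘E f = emb (fun g ∘ fun f) record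
  { cong = IsOrderHomomorphism.cong (isEmb g) ∘ IsOrderHomomorphism.cong (isEmb f)
  ; mono = IsOrderHomomorphism.mono (isEmb g) ∘ IsOrderHomomorphism.mono (isEmb f) }

-- Finite subsets [X]^{<ω}: finite lists, compared up to membership.

Mem : (X : LO) → Car X → List (Car X) → Set
Mem X x l = Any (Eq X x) l

SetEq : (X : LO) → List (Car X) → List (Car X) → Set
SetEq X a b = (∀ {x} → Mem X x a → Mem X x b) × (∀ {x} → Mem X x b → Mem X x a)

-- a <fin b : every s ∈ a has some t ∈ b with s < t ; singletons as elements
LtFin : (X : LO) → List (Car X) → Car X → Set
LtFin X a t = All (λ s → Lt X s t) a

Sub : (X : LO) → List (Car X) → LO
Sub X a = On.strictTotalOrder X (proj₁ {B = λ x → Mem X x a})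

incl : (X : LO) (a : List (Car X)) → Emb (Sub X a) X
incl X a = emb proj₁ record { cong = λ p → p ; mono = λ p → p }

record PraeDilator : Set₁ where
  field
    F      : LO → LO
    mor    : {X Y : LO} → Emb X Y → Emb (F X) (F Y)
    -- functoriality (morphisms compared pointwise, as in a setoid category)
    mor-ext : {X Y : LO} (f g : Emb X Y) → (∀ x → Eq Y (fun f x) (fun g x)) →
              ∀ σ → Eq (F Y) (fun (mor f) σ) (fun (mor g) σ)
    mor-id : (X : LO) → ∀ σ → Eq (F X) (fun (mor (idE X)) σ) σ
    mor-∘  : {X Y Z : LO} (g : Emb Y Z) (f : Emb X Y) →
             ∀ σ → Eq (F Z) (fun (mor (g ∘E f)) σ) (fun (mor g) (fun (mor f) σ))
    supp      : (X : LO) → Car (F X) → List (Car X)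
    supp-cong : (X : LO) → ∀ {σ τ} → Eq (F X) σ τ → SetEq X (supp X σ) (supp X τ)
    supp-nat  : {X Y : LO} (f : Emb X Y) →
                ∀ σ → SetEq Y (supp Y (fun (mor f) σ)) (map (fun f) (supp X σ))
    supp-rng  : (X : LO) → ∀ σ → Σ (Car (F (Sub X (supp X σ))))
                  (λ σ₀ → Eq (F X) (fun (mor (incl X (supp X σ))) σ₀) σ)

record ϑTerm (A : Set) : Set where
  constructor ϑ
  field arg : A
open ϑTerm public

maxL : {A : Set} → (A → ℕ) → List A → ℕ
maxL L = foldr (λ x m → L x ⊔ m) 0

module _ (T : PraeDilator) where
  open PraeDilator T

  ϑT : LO → Set
  ϑT X = ϑTerm (Car (F X))

  ϑEq : (X : LO) → ϑT X → ϑT X → Set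
  ϑEq X a b = Eq (F X) (arg a) (arg b)

  Lϑ : (X : LO) → (Car X → ℕ) → ϑT X → ℕ
  Lϑ X L (ϑ σ) = suc (maxL L (supp X σ))

  -- the order on ϑ_T(X), by recursion with fuel (fuel = L(ϑσ)+L(ϑτ)+1 suffices)
  ltF : (X : LO) → (Car X → ϑT X) → ℕ → ϑT X → ϑT X → Set
  ltF X ι zero a b = ⊥
  ltF X ι (suc n) (ϑ σ) (ϑ τ) =
      (Lt (F X) σ τ × All (λ s → ltF X ι n (ι s) (ϑ τ)) (supp X σ))
    ⊎ (Lt (F X) τ σ × Any (λ t → ltF X ι n (ϑ σ) (ι t) ⊎ ϑEq X (ϑ σ) (ι t)) (supp X τ))

  ϑLt : (X : LO) → (Car X → ϑT X) → (Car X → ℕ) → ϑT X → ϑT X → Set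
  ϑLt X ι L a b = ltF X ι (suc (Lϑ X L a + Lϑ X L b)) a b

  record BHSystem : Set₁ where
    field
      X        : LO
      ι        : Car X → ϑT X
      L        : Car X → ℕ
      ι-cong   : ∀ {x y} → Eq X x y → ϑEq X (ι x) (ι y)
      L-cong   : ∀ {x y} → Eq X x y → L x ≡ L y
      L-compat : ∀ x → Lϑ X L (ι x) ≡ L x

    _<ϑ_ : ϑT X → ϑT X → Set
    _<ϑ_ = ϑLt X ι L

  Good : BHSystem → Set
  Good S = ∀ {x y} → Lt X x y → ϑLt X ι L (ι x) (ι y)
    where open BHSystem S

  ϑLO : (S : BHSystem) → IsStrictTotalOrder (ϑEq (BHSystem.X S)) (BHSystem._<ϑ_ S) → LO
  ϑLO S lin = record { Carrier = ϑT (BHSystem.X S) ; _≈_ = ϑEq (BHSystem.X S)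
                     ; _<_ = BHSystem._<ϑ_ S ; isStrictTotalOrder = lin }

  private
    ∈-≤ : (X : LO) (L : Car X → ℕ) → (∀ {x y} → Eq X x y → L x ≡ L y) →
          ∀ {x} {k : List (Car X)} → Mem X x k → L x ≤ maxL L k
    ∈-≤ X L Lc {x} {y ∷ k} (here p) = ≤-trans (≤-reflexive (Lc p)) (m≤m⊔n (L y) _)
    ∈-≤ X L Lc {x} {y ∷ k} (there p) = ≤-trans (∈-≤ X L Lc p) (m≤n⊔m (L y) _)

    ⊆-≤ : (X : LO) (L : Car X → ℕ) → (∀ {x y} → Eq X x y → L x ≡ L y) →
          (l k : List (Car X)) → (∀ {x} → Mem X x l → Mem X x k) → maxL L l ≤ maxL L k
    ⊆-≤ X L Lc [] k p = z≤n
    ⊆-≤ X L Lc (x ∷ l) k p =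
      ⊔-lub (∈-≤ X L Lc (p (here (StrictTotalOrder.Eq.refl X)))) (⊆-≤ X L Lc l k (p ∘ there))

    ≐-≡ : (X : LO) (L : Car X → ℕ) → (∀ {x y} → Eq X x y → L x ≡ L y) →
          (l k : List (Car X)) → SetEq X l k → maxL L l ≡ maxL L k
    ≐-≡ X L Lc l k (p , q) = ≤-antisym (⊆-≤ X L Lc l k p) (⊆-≤ X L Lc k l q)

    map-max : {A B : Set} (f : A → B) (L' : B → ℕ) (L : A → ℕ) → (∀ x → L' (f x) ≡ L x) →
              (l : List A) → maxL L' (map f l) ≡ maxL L l
    map-max f L' L e [] = refl
    map-max f L' L e (x ∷ l) = trans (cong (_⊔ maxL L' (map f l)) (e x))
                                     (cong (L x ⊔_) (map-max f L' L e l))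

  next : (S : BHSystem) → Good S →
         (lin : IsStrictTotalOrder (ϑEq (BHSystem.X S)) (BHSystem._<ϑ_ S)) → BHSystem
  next S g lin = record
    { X = Y
    ; ι = ι'
    ; L = Lϑ X L
    ; ι-cong = λ {a} {b} p → IsOrderHomomorphism.cong (isEmb (mor ιE)) p
    ; L-cong = L'cong
    ; L-compat = compat
    }
    where
      open BHSystem S
      Y = ϑLO S lin
      ιE : Emb X Y
      ιE = emb ι record { cong = ι-cong ; mono = g }
      ι' : ϑT X → ϑT Y
      ι' (ϑ σ) = ϑ (fun (mor ιE) σ)
      L'cong : ∀ {a b} → ϑEq X a b → Lϑ X L a ≡ Lϑ X L b
      L'cong {ϑ σ} {ϑ τ} p = cong suc (≐-≡ X L L-cong _ _ (supp-cong X p))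
      compat : ∀ a → Lϑ Y (Lϑ X L) (ι' a) ≡ Lϑ X L a
      compat (ϑ σ) = cong suc (trans (≐-≡ Y (Lϑ X L) L'cong _ _ (supp-nat ιE σ))
                                     (map-max ι (Lϑ X L) L L-compat (supp X σ)))

  emptyLO : LO
  emptyLO = record
    { Carrier = ⊥ ; _≈_ = λ _ _ → ⊥ ; _<_ = λ _ _ → ⊥
    ; isStrictTotalOrder = record
      { isStrictPartialOrder = record
        { isEquivalence = record { refl = λ {x} → ⊥-elim x ; sym = λ () ; trans = λ () }
        ; irrefl = λ ()
        ; trans = λ ()
        ; <-resp-≈ = (λ {x} → ⊥-elim x) , (λ {x} → ⊥-elim x) }
      ; compare = λ () } }

  emptySys : BHSystem
  emptySys = record
    { X = emptyLO ; ι = λ () ; L = λ () ; ι-cong = λ () ; L-cong = λ () ; L-compat = λ () }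

  emptyGood : Good emptySys
  emptyGood {x} = ⊥-elim x

  Facts : Set₁
  Facts = (S : BHSystem) (g : Good S) →
          Σ (IsStrictTotalOrder (ϑEq (BHSystem.X S)) (BHSystem._<ϑ_ S))
            (λ lin → Good (next S g lin))

  stage : Facts → ℕ → Σ BHSystem Good
  stage H zero = emptySys , λ {x} {y} → emptyGood {x} {y}
  stage H (suc n) =
    next (proj₁ (stage H n)) (proj₂ (stage H n)) (proj₁ (H (proj₁ (stage H n)) (proj₂ (stage H n))))
    , proj₂ (H (proj₁ (stage H n)) (proj₂ (stage H n)))

  Xn : Facts → ℕ → LO
  Xn H n = BHSystem.X (proj₁ (stage H n))

  ιn : (H : Facts) (n : ℕ) → Car (Xn H n) → Car (Xn H (suc n))
  ιn H n = BHSystem.ι (proj₁ (stage H n))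

  up : (H : Facts) {m n : ℕ} → m ≤′ n → Car (Xn H m) → Car (Xn H n)
  up H ≤′-refl x = x
  up H {m} {suc n} (≤′-step p) x = ιn H n (up H p x)

  BHCar : Facts → Set
  BHCar H = Σ ℕ (λ n → Car (Xn H n))

  BHEq : (H : Facts) → BHCar H → BHCar H → Set
  BHEq H (m , x) (n , y) =
    Eq (Xn H (m ⊔ n)) (up H (≤⇒≤′ (m≤m⊔n m n)) x) (up H (≤⇒≤′ (m≤n⊔m m n)) y)

  BHLt : (H : Facts) → BHCar H → BHCar H → Set
  BHLt H (m , x) (n , y) =
    Lt (Xn H (m ⊔ n)) (up H (≤⇒≤′ (m≤m⊔n m n)) x) (up H (≤⇒≤′ (m≤n⊔m m n)) y)

  BH : (H : Facts) → IsStrictTotalOrder (BHEq H) (BHLt H) → LO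
  BH H lin = record { Carrier = BHCar H ; _≈_ = BHEq H ; _<_ = BHLt H ; isStrictTotalOrder = lin }

-- For every Bachmann–Howard system, induction on L(ϑσ) + L(ϑτ) shows that ϑ_T(X) is
-- linearly ordered and that ι_{ϑ_T(X)} is an embedding whenever ι_X is; this builds the
-- tower X_n and makes its direct limit BH(T) linear. An element σ of T_{BH(T)} has finite
-- support, contained in some stage X_N, so by the support condition it is the image of a
-- code ρ ∈ T_{X_N}, and θσ := ϑρ ∈ X_{N+1}. Comparing two codes at a common stage K,
-- clause (i) is the first clause of the order on ϑ_T(X_K). Clause (ii) comes from the
-- invariant "ι x < ϑρ whenever x lies below an element of supp ρ", which passes from X_n
-- to X_{n+1} by induction on L(x), because the support of T_ι(π) lies below ϑπ.

module Submission where

open import Function using (_∘_)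
open import Data.Empty using (⊥-elim)
open import Data.Nat using (ℕ; zero; suc; _+_; _⊔_; _≤_; _<_; s≤s; _≤′_; ≤′-refl; ≤′-step)
open import Data.Nat.Properties
  using ( ≤-trans; <-≤-trans; <-irrefl; n<1+n; +-comm; +-assoc; +-monoˡ-<; +-monoʳ-<
        ; m≤m⊔n; m≤n⊔m; ⊔-lub; ≤⇒≤′; ≤′⇒≤; ≤′-trans; s≤′s)
open import Data.Product using (Σ; _×_; _,_; proj₁; proj₂)
open import Data.Sum as Sum using (_⊎_; inj₁; inj₂)
open import Data.List using (List; []; _∷_)
open import Data.List.Relation.Unary.All as All using (All; []; _∷_)
open import Data.List.Relation.Unary.Any as Any using (Any; here; there)
open import Data.List.Relation.Unary.Any.Properties using (map⁺; map⁻)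
open import Relation.Binary using (StrictTotalOrder; IsStrictTotalOrder; Tri; tri<; tri≈; tri>)
open import Relation.Binary.Morphism.Structures using (IsOrderHomomorphism)
open import Relation.Binary.PropositionalEquality using (_≡_; refl; cong; subst; subst₂)
  renaming (sym to ≡-sym; trans to ≡-trans)
open import Relation.Nullary using (¬_)
open import Defs

module _ {A : Set} {P Q : A → Set} where

  all-any-∩ : ∀ {xs} → All P xs → Any Q xs → Any (λ x → P x × Q x) xs
  all-any-∩ (p ∷ _)  (here q)  = here (p , q)
  all-any-∩ (_ ∷ ps) (there q) = there (all-any-∩ ps q)

  all⊎any : ∀ {xs} → All (λ x → P x ⊎ Q x) xs → All P xs ⊎ Any Q xs
  all⊎any []             = inj₁ []
  all⊎any (inj₂ q ∷ _)   = inj₂ (here q)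
  all⊎any (inj₁ p ∷ pqs) with all⊎any pqs
  ... | inj₁ ps = inj₁ (p ∷ ps)
  ... | inj₂ qs = inj₂ (there qs)

maxL-bounds : {A : Set} (L : A → ℕ) (xs : List A) → All (λ x → L x ≤ maxL L xs) xs
maxL-bounds L []       = []
maxL-bounds L (x ∷ xs) =
  m≤m⊔n (L x) _ ∷ All.map (λ b → ≤-trans b (m≤n⊔m (L x) _)) (maxL-bounds L xs)

≤′-irrelevant : ∀ {m n} (p q : m ≤′ n) → p ≡ q
≤′-irrelevant ≤′-refl     ≤′-refl     = refl
≤′-irrelevant ≤′-refl     (≤′-step q) = ⊥-elim (<-irrefl refl (≤′⇒≤ q))
≤′-irrelevant (≤′-step p) ≤′-refl     = ⊥-elim (<-irrefl refl (≤′⇒≤ p))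
≤′-irrelevant (≤′-step p) (≤′-step q) = cong ≤′-step (≤′-irrelevant p q)

module _ {X Y : LO} (f : Emb X Y) where
  private
    module X = StrictTotalOrder X
    module Y = StrictTotalOrder Y
    open IsOrderHomomorphism (isEmb f) renaming (cong to f-cong; mono to f-mono)

  emb-reflects-< : ∀ {x y} → Lt Y (fun f x) (fun f y) → Lt X x y
  emb-reflects-< {x} {y} fx<fy with X.compare x y
  ... | tri< x<y _ _ = x<y
  ... | tri≈ _ x≈y _ = ⊥-elim (Y.irrefl (f-cong x≈y) fx<fy)
  ... | tri> _ _ y<x = ⊥-elim (Y.asym fx<fy (f-mono y<x))

  emb-reflects-≈ : ∀ {x y} → Eq Y (fun f x) (fun f y) → Eq X x y
  emb-reflects-≈ {x} {y} fx≈fy with X.compare x y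
  ... | tri< x<y _ _ = ⊥-elim (Y.irrefl fx≈fy (f-mono x<y))
  ... | tri≈ _ x≈y _ = x≈y
  ... | tri> _ _ y<x = ⊥-elim (Y.irrefl (Y.Eq.sym fx≈fy) (f-mono y<x))

module SuppImage (T : PraeDilator) {Y Z : LO} (f : Emb Y Z) where
  open PraeDilator T

  supp-image⁻ : ∀ {ρ σ z} → Eq (F Z) (fun (mor f) ρ) σ →
                Mem Z z (supp Z σ) → Any (λ y → Eq Z z (fun f y)) (supp Y ρ)
  supp-image⁻ {ρ} fρ≈σ z∈ =
    map⁻ (proj₁ (supp-nat f ρ) (proj₂ (supp-cong Z fρ≈σ) z∈))

  supp-image⁺ : ∀ {ρ σ y} → Eq (F Z) (fun (mor f) ρ) σ →
                Mem Y y (supp Y ρ) → Mem Z (fun f y) (supp Z σ)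
  supp-image⁺ {ρ} fρ≈σ y∈ =
    proj₁ (supp-cong Z fρ≈σ) (proj₂ (supp-nat f ρ)
      (map⁺ (Any.map (IsOrderHomomorphism.cong (isEmb f)) y∈)))

module ϑOrder {T : PraeDilator} (S : BHSystem T) where
  open PraeDilator T
  open BHSystem S
  private
    module X = StrictTotalOrder X
    module FX = StrictTotalOrder (F X)
  open import Data.List.Membership.Setoid X.Eq.setoid using (find)

  infix 4 _≈ϑ_
  _≈ϑ_ : ϑT T X → ϑT T X → Set
  _≈ϑ_ = ϑEq T X

  ℓ : ϑT T X → ℕ
  ℓ = Lϑ T X L

  height : Car (F X) → ℕ
  height σ = maxL L (supp X σ)

  ι-shrinks : ∀ {s σ} → L s ≤ height σ → ℓ (ι s) < ℓ (ϑ σ)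
  ι-shrinks {s} {σ} s≤ = subst (_< ℓ (ϑ σ)) (≡-sym (L-compat s)) (s≤s s≤)

  shrinkˡ : ∀ {s σ} b → L s ≤ height σ → ℓ (ι s) + ℓ b < ℓ (ϑ σ) + ℓ b
  shrinkˡ b s≤ = +-monoˡ-< (ℓ b) (ι-shrinks s≤)

  shrinkʳ : ∀ {t τ} a → L t ≤ height τ → ℓ a + ℓ (ι t) < ℓ a + ℓ (ϑ τ)
  shrinkʳ a t≤ = +-monoʳ-< (ℓ a) (ι-shrinks t≤)

  -- ltF (suc n) (ϑ σ) (ϑ τ) is definitionally Clause (ltF n) σ τ.
  Clause : (ϑT T X → ϑT T X → Set) → Car (F X) → Car (F X) → Set
  Clause _≺_ σ τ =
      (Lt (F X) σ τ × All (λ s → ι s ≺ ϑ τ) (supp X σ))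
    ⊎ (Lt (F X) τ σ × Any (λ t → ϑ σ ≺ ι t ⊎ ϑ σ ≈ϑ ι t) (supp X τ))

  clause-map : ∀ {P Q : ϑT T X → ϑT T X → Set} {σ τ} →
               (∀ {s} → L s ≤ height σ → P (ι s) (ϑ τ) → Q (ι s) (ϑ τ)) →
               (∀ {t} → L t ≤ height τ → P (ϑ σ) (ι t) → Q (ϑ σ) (ι t)) →
               Clause P σ τ → Clause Q σ τ
  clause-map {σ = σ} f g (inj₁ (σ<τ , below)) =
    inj₁ (σ<τ , All.zipWith (λ (b , p) → f b p) (maxL-bounds L (supp X σ) , below))
  clause-map {P} {Q} {σ} {τ} f g (inj₂ (τ<σ , above)) =
    inj₂ (τ<σ , Any.map step (all-any-∩ (maxL-bounds L (supp X τ)) above))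
    where
      step : ∀ {t} → L t ≤ height τ × (P (ϑ σ) (ι t) ⊎ ϑ σ ≈ϑ ι t) → Q (ϑ σ) (ι t) ⊎ ϑ σ ≈ϑ ι t
      step (b , p) = Sum.map₁ (g b) p

  ltF-fuel : ∀ m n a b → ℓ a + ℓ b < m → ℓ a + ℓ b < n → ltF T X ι m a b → ltF T X ι n a b
  ltF-fuel (suc m) (suc n) (ϑ σ) (ϑ τ) (s≤s hm) (s≤s hn) = clause-map {ltF T X ι m} {ltF T X ι n}
    (λ {s} b → ltF-fuel m n (ι s) (ϑ τ) (<-≤-trans (shrinkˡ _ b) hm) (<-≤-trans (shrinkˡ _ b) hn))
    (λ {t} b → ltF-fuel m n (ϑ σ) (ι t) (<-≤-trans (shrinkʳ _ b) hm) (<-≤-trans (shrinkʳ _ b) hn))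

  ϑ<-fold : ∀ {σ τ} → Clause _<ϑ_ σ τ → ϑ σ <ϑ ϑ τ
  ϑ<-fold {σ} {τ} = clause-map {_<ϑ_} {ltF T X ι (ℓ (ϑ σ) + ℓ (ϑ τ))}
    (λ {s} b → ltF-fuel _ _ (ι s) (ϑ τ) (n<1+n _) (shrinkˡ _ b))
    (λ {t} b → ltF-fuel _ _ (ϑ σ) (ι t) (n<1+n _) (shrinkʳ _ b))

  ϑ<-unfold : ∀ {σ τ} → ϑ σ <ϑ ϑ τ → Clause _<ϑ_ σ τ
  ϑ<-unfold {σ} {τ} = clause-map {ltF T X ι (ℓ (ϑ σ) + ℓ (ϑ τ))} {_<ϑ_}
    (λ {s} b → ltF-fuel _ _ (ι s) (ϑ τ) (shrinkˡ _ b) (n<1+n _))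
    (λ {t} b → ltF-fuel _ _ (ϑ σ) (ι t) (shrinkʳ _ b) (n<1+n _))

  respˡ-≈-fuel : ∀ n a a' b → ℓ a + ℓ b < n → a ≈ϑ a' → a <ϑ b → a' <ϑ b
  respˡ-≈-fuel (suc n) (ϑ σ) (ϑ σ') (ϑ τ) (s≤s h) σ≈σ' σ<τ with ϑ<-unfold σ<τ
  ... | inj₁ (σ<τ , below) =
    ϑ<-fold (inj₁ (FX.<-respˡ-≈ σ≈σ' σ<τ , All.tabulateₛ X.Eq.setoid below′))
    where
      below′ : ∀ {s'} → Mem X s' (supp X σ') → ι s' <ϑ ϑ τ
      below′ s'∈ with Any.satisfied (all-any-∩ (All.zip (maxL-bounds L (supp X σ) , below))
                                               (proj₂ (supp-cong X σ≈σ') s'∈))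
      ... | s , (b , ιs<τ) , s'≈s = respˡ-≈-fuel n (ι s) (ι _) (ϑ τ)
              (<-≤-trans (shrinkˡ _ b) h) (ι-cong (X.Eq.sym s'≈s)) ιs<τ
  ... | inj₂ (τ<σ , above) =
    ϑ<-fold (inj₂ (FX.<-respʳ-≈ σ≈σ' τ<σ , Any.map above′ (all-any-∩ (maxL-bounds L (supp X τ)) above)))
    where
      above′ : ∀ {t} → L t ≤ height τ × (ϑ σ <ϑ ι t ⊎ ϑ σ ≈ϑ ι t) → ϑ σ' <ϑ ι t ⊎ ϑ σ' ≈ϑ ι t
      above′ {t} (b , σ≤ιt) = Sum.map
        (respˡ-≈-fuel n (ϑ σ) (ϑ σ') (ι t) (<-≤-trans (shrinkʳ _ b) h) σ≈σ')
        (FX.Eq.trans (FX.Eq.sym σ≈σ')) σ≤ιt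

  respʳ-≈-fuel : ∀ n a b b' → ℓ a + ℓ b < n → b ≈ϑ b' → a <ϑ b → a <ϑ b'
  respʳ-≈-fuel (suc n) (ϑ σ) (ϑ τ) (ϑ τ') (s≤s h) τ≈τ' σ<τ with ϑ<-unfold σ<τ
  ... | inj₁ (σ<τ , below) = ϑ<-fold (inj₁ (FX.<-respʳ-≈ τ≈τ' σ<τ , All.zipWith below′ (maxL-bounds L (supp X σ) , below)))
    where
      below′ : ∀ {s} → L s ≤ height σ × ι s <ϑ ϑ τ → ι s <ϑ ϑ τ'
      below′ {s} (b , ιs<τ) = respʳ-≈-fuel n (ι s) (ϑ τ) (ϑ τ') (<-≤-trans (shrinkˡ _ b) h) τ≈τ' ιs<τ
  ... | inj₂ (τ<σ , above) with find (all-any-∩ (maxL-bounds L (supp X τ)) above)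
  ...   | t , t∈ , b , σ≤ιt =
    ϑ<-fold (inj₂ (FX.<-respˡ-≈ τ≈τ' τ<σ , Any.map above′ (proj₁ (supp-cong X τ≈τ') t∈)))
    where
      above′ : ∀ {t'} → Eq X t t' → ϑ σ <ϑ ι t' ⊎ ϑ σ ≈ϑ ι t'
      above′ {t'} t≈t' = Sum.map
        (respʳ-≈-fuel n (ϑ σ) (ι t) (ι t') (<-≤-trans (shrinkʳ _ b) h) (ι-cong t≈t'))
        (λ σ≈ιt → FX.Eq.trans σ≈ιt (ι-cong t≈t')) σ≤ιt

  <ϑ-irrefl : ∀ {a b} → a ≈ϑ b → ¬ a <ϑ b
  <ϑ-irrefl {ϑ σ} {ϑ τ} σ≈τ σ<τ with ϑ<-unfold σ<τ
  ... | inj₁ (σ<τ , _) = FX.irrefl σ≈τ σ<τ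
  ... | inj₂ (τ<σ , _) = FX.irrefl (FX.Eq.sym σ≈τ) τ<σ

  Trichotomy : ϑT T X → ϑT T X → Set
  Trichotomy a b = Tri (a <ϑ b) (a ≈ϑ b) (b <ϑ a)

  tri-flip : ∀ {a b} → Trichotomy b a → Trichotomy a b
  tri-flip (tri< b<a b≉a a≮b) = tri> a≮b (b≉a ∘ FX.Eq.sym) b<a
  tri-flip (tri≈ b≮a b≈a a≮b) = tri≈ a≮b (FX.Eq.sym b≈a) b≮a
  tri-flip (tri> b≮a b≉a a<b) = tri< a<b (b≉a ∘ FX.Eq.sym) b≮a

  tri-split : ∀ {a b} → Trichotomy a b →
              (a <ϑ b × ¬ b <ϑ a × ¬ b ≈ϑ a) ⊎ ((b <ϑ a ⊎ b ≈ϑ a) × ¬ a <ϑ b)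
  tri-split (tri< a<b a≉b b≮a) = inj₁ (a<b , b≮a , a≉b ∘ FX.Eq.sym)
  tri-split (tri≈ a≮b a≈b _)   = inj₂ (inj₂ (FX.Eq.sym a≈b) , a≮b)
  tri-split (tri> a≮b _ b<a)   = inj₂ (inj₁ b<a , a≮b)

  compare-fuel : ∀ n a b → ℓ a + ℓ b < n → Trichotomy a b
  compare-<-fuel : ∀ n σ τ → ℓ (ϑ σ) + ℓ (ϑ τ) ≤ n → Lt (F X) σ τ → Trichotomy (ϑ σ) (ϑ τ)

  compare-fuel (suc n) (ϑ σ) (ϑ τ) (s≤s h) with FX.compare σ τ
  ... | tri< σ<τ _ _ = compare-<-fuel n σ τ h σ<τ
  ... | tri≈ _ σ≈τ _ = tri≈ (<ϑ-irrefl σ≈τ) σ≈τ (<ϑ-irrefl (FX.Eq.sym σ≈τ))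
  ... | tri> _ _ τ<σ = tri-flip (compare-<-fuel n τ σ (subst (_≤ n) (+-comm (ℓ (ϑ σ)) _) h) τ<σ)

  compare-<-fuel n σ τ h σ<τ
    with all⊎any (All.map (λ {s} b → tri-split (compare-fuel n (ι s) (ϑ τ) (<-≤-trans (shrinkˡ _ b) h)))
                          (maxL-bounds L (supp X σ)))
  ... | inj₁ below = tri< (ϑ<-fold (inj₁ (σ<τ , All.map proj₁ below))) (λ σ≈τ → FX.irrefl σ≈τ σ<τ) τ≮σ
    where
      τ≮σ : ¬ ϑ τ <ϑ ϑ σ
      τ≮σ τ<σ with ϑ<-unfold τ<σ
      ... | inj₁ (τ<σ , _) = FX.asym σ<τ τ<σ
      ... | inj₂ (_ , above) with Any.satisfied (all-any-∩ below above)
      ...   | _ , (_ , τ≮ιs , _) , inj₁ τ<ιs = τ≮ιs τ<ιs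
      ...   | _ , (_ , _ , τ≉ιs) , inj₂ τ≈ιs = τ≉ιs τ≈ιs
  ... | inj₂ above = tri> σ≮τ (λ σ≈τ → FX.irrefl σ≈τ σ<τ) (ϑ<-fold (inj₂ (σ<τ , Any.map proj₁ above)))
    where
      σ≮τ : ¬ ϑ σ <ϑ ϑ τ
      σ≮τ σ<τ′ with ϑ<-unfold σ<τ′
      ... | inj₂ (τ<σ , _) = FX.asym σ<τ τ<σ
      ... | inj₁ (_ , below) with Any.satisfied (all-any-∩ below above)
      ...   | _ , ιs<τ , (_ , ιs≮τ) = ιs≮τ ιs<τ

  <ϑ-compare : ∀ a b → Trichotomy a b
  <ϑ-compare a b = compare-fuel _ a b (n<1+n _)

  <ϑ-asym : ∀ {a b} → a <ϑ b → ¬ b <ϑ a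
  <ϑ-asym {a} {b} a<b b<a with <ϑ-compare a b
  ... | tri< _ _ b≮a = b≮a b<a
  ... | tri≈ a≮b _ _ = a≮b a<b
  ... | tri> a≮b _ _ = a≮b a<b

  <ϑ-respˡ-≈ : ∀ {a a' b} → a ≈ϑ a' → a <ϑ b → a' <ϑ b
  <ϑ-respˡ-≈ = respˡ-≈-fuel _ _ _ _ (n<1+n _)

  <ϑ-respʳ-≈ : ∀ {a b b'} → b ≈ϑ b' → a <ϑ b → a <ϑ b'
  <ϑ-respʳ-≈ = respʳ-≈-fuel _ _ _ _ (n<1+n _)

  trans-fuel : ∀ n a b c → ℓ a + ℓ b + ℓ c < n → a <ϑ b → b <ϑ c → a <ϑ c
  trans-fuel (suc n) (ϑ ρ) (ϑ σ) (ϑ τ) (s≤s h) ϑρ<ϑσ ϑσ<ϑτ = cases (ϑ<-unfold ϑρ<ϑσ) (ϑ<-unfold ϑσ<ϑτ)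
    where
      rotate : ∀ {x y} u v → x < y → u + x + v < y + v + u
      rotate {x} {y} u v x<y =
        subst (_< y + v + u) (≡-trans (+-comm (x + v) u) (≡-sym (+-assoc u x v))) (+-monoˡ-< u (+-monoˡ-< v x<y))

      ρ<ιt : ∀ {t} → L t ≤ height τ → ϑ σ <ϑ ι t ⊎ ϑ σ ≈ϑ ι t → ϑ ρ <ϑ ι t
      ρ<ιt {t} b (inj₁ σ<ιt) = trans-fuel n (ϑ ρ) (ϑ σ) (ι t)
        (<-≤-trans (+-monoʳ-< (ℓ (ϑ ρ) + ℓ (ϑ σ)) (ι-shrinks b)) h) ϑρ<ϑσ σ<ιt
      ρ<ιt b (inj₂ σ≈ιt) = <ϑ-respʳ-≈ σ≈ιt ϑρ<ϑσ

      ιr<τ : ∀ {r} → L r ≤ height ρ → ι r <ϑ ϑ σ → ι r <ϑ ϑ τ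
      ιr<τ {r} b ιr<σ with <ϑ-compare (ι r) (ϑ τ)
      ... | tri< ιr<τ _ _ = ιr<τ
      ... | tri≈ _ ιr≈τ _ = ⊥-elim (<ϑ-asym ϑσ<ϑτ (<ϑ-respˡ-≈ ιr≈τ ιr<σ))
      ... | tri> _ _ τ<ιr = ⊥-elim (<ϑ-asym ϑσ<ϑτ (trans-fuel n (ϑ τ) (ι r) (ϑ σ)
              (<-≤-trans (rotate (ℓ (ϑ τ)) (ℓ (ϑ σ)) (ι-shrinks b)) h) τ<ιr ιr<σ))

      cases : Clause _<ϑ_ ρ σ → Clause _<ϑ_ σ τ → ϑ ρ <ϑ ϑ τ
      cases (inj₁ (ρ<σ , below)) (inj₁ (σ<τ , _)) =
        ϑ<-fold (inj₁ (FX.trans ρ<σ σ<τ , All.zipWith ιr<τ′ (maxL-bounds L (supp X ρ) , below)))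
        where
          ιr<τ′ : ∀ {r} → L r ≤ height ρ × ι r <ϑ ϑ σ → ι r <ϑ ϑ τ
          ιr<τ′ {r} (b , ιr<σ) = trans-fuel n (ι r) (ϑ σ) (ϑ τ)
            (<-≤-trans (+-monoˡ-< (ℓ (ϑ τ)) (shrinkˡ (ϑ σ) b)) h) ιr<σ ϑσ<ϑτ
      cases (inj₁ (_ , below)) (inj₂ (_ , above)) with FX.compare ρ τ
      ... | tri< ρ<τ _ _ =
        ϑ<-fold (inj₁ (ρ<τ , All.zipWith (λ (b , p) → ιr<τ b p) (maxL-bounds L (supp X ρ) , below)))
      ... | tri≈ _ ρ≈τ _ = ⊥-elim (<ϑ-asym ϑσ<ϑτ (<ϑ-respˡ-≈ ρ≈τ ϑρ<ϑσ))
      ... | tri> _ _ τ<ρ =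
        ϑ<-fold (inj₂ (τ<ρ , Any.map (λ (b , p) → inj₁ (ρ<ιt b p)) (all-any-∩ (maxL-bounds L (supp X τ)) above)))
      cases (inj₂ (_ , above)) (inj₁ (_ , below))
        with Any.satisfied (all-any-∩ (All.zip (maxL-bounds L (supp X σ) , below)) above)
      ... | s , (b , ιs<τ) , inj₁ ρ<ιs = trans-fuel n (ϑ ρ) (ι s) (ϑ τ)
              (<-≤-trans (+-monoˡ-< (ℓ (ϑ τ)) (shrinkʳ (ϑ ρ) b)) h) ρ<ιs ιs<τ
      ... | _ , (_ , ιs<τ) , inj₂ ρ≈ιs = <ϑ-respˡ-≈ (FX.Eq.sym ρ≈ιs) ιs<τ
      cases (inj₂ (σ<ρ , _)) (inj₂ (τ<σ , above)) =
        ϑ<-fold (inj₂ (FX.trans τ<σ σ<ρ , Any.map (λ (b , p) → inj₁ (ρ<ιt b p)) (all-any-∩ (maxL-bounds L (supp X τ)) above)))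

  <ϑ-trans : ∀ {a b c} → a <ϑ b → b <ϑ c → a <ϑ c
  <ϑ-trans = trans-fuel _ _ _ _ (n<1+n _)

  ϑ-isStrictTotalOrder : IsStrictTotalOrder _≈ϑ_ _<ϑ_
  ϑ-isStrictTotalOrder = record
    { isStrictPartialOrder = record
      { isEquivalence = record { refl = FX.Eq.refl ; sym = FX.Eq.sym ; trans = FX.Eq.trans }
      ; irrefl = <ϑ-irrefl
      ; trans = <ϑ-trans
      ; <-resp-≈ = <ϑ-respʳ-≈ , <ϑ-respˡ-≈ }
    ; compare = <ϑ-compare }

SuppBelowϑ : (T : PraeDilator) → BHSystem T → Set
SuppBelowϑ T S = ∀ ρ x → Any (λ y → Lt X x y ⊎ Eq X x y) (PraeDilator.supp T X ρ) → ι x <ϑ ϑ ρ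
  where open BHSystem S

emptySys-suppBelowϑ : (T : PraeDilator) → SuppBelowϑ T (emptySys T)
emptySys-suppBelowϑ T ρ ()

module Next {T : PraeDilator} (S : BHSystem T) (good : Good T S)
            (lin : IsStrictTotalOrder (ϑEq T (BHSystem.X S)) (BHSystem._<ϑ_ S)) where
  open PraeDilator T
  open BHSystem S
  open ϑOrder S
  private
    Y : LO
    Y = ϑLO T S lin
    module Y = StrictTotalOrder Y
    module FY = StrictTotalOrder (F Y)
    S' : BHSystem T
    S' = next T S good lin
    module S' = BHSystem S'
    module O' = ϑOrder S'
    ιₑ : Emb X Y
    ιₑ = emb ι record { cong = ι-cong ; mono = good }
    open SuppImage T ιₑ
    open import Data.List.Membership.Setoid (StrictTotalOrder.Eq.setoid X) using (find)
    open import Data.List.Membership.Setoid Y.Eq.setoid using () renaming (find to findY)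
    open import Relation.Binary.Construct.StrictToNonStrict (Eq Y) (Lt Y)
      using () renaming (<-≤-trans to <≤-trans)

  next-mono-fuel : ∀ n a b → ℓ a + ℓ b < n → a <ϑ b → S'.ι a S'.<ϑ S'.ι b
  next-mono-fuel (suc n) (ϑ σ) (ϑ τ) (s≤s h) ϑσ<ϑτ with ϑ<-unfold ϑσ<ϑτ
  ... | inj₁ (σ<τ , below) =
    O'.ϑ<-fold (inj₁ (IsOrderHomomorphism.mono (isEmb (mor ιₑ)) σ<τ , All.tabulateₛ Y.Eq.setoid below′))
    where
      below′ : ∀ {y} → Mem Y y (supp Y (fun (mor ιₑ) σ)) → S'.ι y S'.<ϑ ϑ (fun (mor ιₑ) τ)
      below′ y∈ with Any.satisfied (all-any-∩ (All.zip (maxL-bounds L (supp X σ) , below))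
                                              (supp-image⁻ FY.Eq.refl y∈))
      ... | s , (b , ιs<τ) , y≈ιs = O'.<ϑ-respˡ-≈ (S'.ι-cong (Y.Eq.sym y≈ιs))
              (next-mono-fuel n (ι s) (ϑ τ) (<-≤-trans (shrinkˡ _ b) h) ιs<τ)
  ... | inj₂ (τ<σ , above) with find (all-any-∩ (maxL-bounds L (supp X τ)) above)
  ...   | t , t∈ , b , σ≤ιt =
    O'.ϑ<-fold (inj₂ (IsOrderHomomorphism.mono (isEmb (mor ιₑ)) τ<σ , Any.map above′ (supp-image⁺ FY.Eq.refl t∈)))
    where
      above′ : ∀ {y} → Eq Y (ι t) y → S'.ι (ϑ σ) S'.<ϑ S'.ι y ⊎ S'.ι (ϑ σ) O'.≈ϑ S'.ι y
      above′ ιt≈y = Sum.map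
        (λ σ<ιt → O'.<ϑ-respʳ-≈ (S'.ι-cong ιt≈y) (next-mono-fuel n (ϑ σ) (ι t) (<-≤-trans (shrinkʳ _ b) h) σ<ιt))
        (λ σ≈ιt → FY.Eq.trans (S'.ι-cong σ≈ιt) (S'.ι-cong ιt≈y)) σ≤ιt

  next-good : Good T S'
  next-good {a} {b} = next-mono-fuel _ a b (n<1+n _)

  module _ (below : SuppBelowϑ T S) where

    supp-ι-below : ∀ π {y} → Mem Y y (supp Y (fun (mor ιₑ) π)) → Lt Y y (ϑ π) × ℓ y < ℓ (ϑ π)
    supp-ι-below π y∈ with find (all-any-∩ (maxL-bounds L (supp X π)) (supp-image⁻ FY.Eq.refl y∈))
    ... | z , z∈ , b , y≈ιz =
      <ϑ-respˡ-≈ (Y.Eq.sym y≈ιz) (below π z (Any.map inj₂ z∈)) ,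
      subst (_< ℓ (ϑ π)) (≡-sym (S'.L-cong y≈ιz)) (ι-shrinks b)

    next-suppBelow-fuel : ∀ n ρ x → ℓ x < n → Any (λ y → Lt Y x y ⊎ Eq Y x y) (supp Y ρ) →
                          S'.ι x S'.<ϑ ϑ ρ
    next-suppBelow-fuel (suc n) ρ (ϑ π) (s≤s h) x≤ with FY.compare (fun (mor ιₑ) π) ρ
    ... | tri< π'<ρ _ _ = O'.ϑ<-fold (inj₁ (π'<ρ , All.tabulateₛ Y.Eq.setoid below′))
      where
        below′ : ∀ {y} → Mem Y y (supp Y (fun (mor ιₑ) π)) → S'.ι y S'.<ϑ ϑ ρ
        below′ y∈ with supp-ι-below π y∈
        ... | y<x , ℓy<ℓx = next-suppBelow-fuel n ρ _ (<-≤-trans ℓy<ℓx h)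
                (Any.map (λ x≤x' → inj₁ (<≤-trans Y.trans Y.<-respʳ-≈ y<x x≤x')) x≤)
    ... | tri> _ _ ρ<π' = O'.ϑ<-fold (inj₂ (ρ<π' , Any.map (Sum.map (λ x<y → next-good x<y) S'.ι-cong) x≤))
    ... | tri≈ _ π'≈ρ _ with findY x≤
    ...   | x' , x'∈ , x≤x' = ⊥-elim (Y.irrefl Y.Eq.refl (<≤-trans Y.trans Y.<-respʳ-≈ x'<x x≤x'))
      where
        x'<x : Lt Y x' (ϑ π)
        x'<x = proj₁ (supp-ι-below π (proj₂ (supp-cong Y π'≈ρ) x'∈))

    next-suppBelow : SuppBelowϑ T S'
    next-suppBelow ρ x = next-suppBelow-fuel _ ρ x (n<1+n _)

-- Opaque: otherwise type checking unfolds the whole tower of stages built from it.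
opaque
  bh-facts : (T : PraeDilator) → Facts T
  bh-facts T S good = ϑOrder.ϑ-isStrictTotalOrder S , Next.next-good S good _

module Limit (T : PraeDilator) where
  open PraeDilator T

  H : Facts T
  H = bh-facts T

  S : ℕ → BHSystem T
  S n = proj₁ (stage T H n)

  X : ℕ → LO
  X n = Xn T H n
  module X (n : ℕ) = StrictTotalOrder (X n)

  stage-suppBelowϑ : ∀ n → SuppBelowϑ T (S n)
  stage-suppBelowϑ zero    = emptySys-suppBelowϑ T
  stage-suppBelowϑ (suc n) =
    Next.next-suppBelow (S n) good (proj₁ (H (S n) good)) (stage-suppBelowϑ n)
    where good = proj₂ (stage T H n)

  ιₑ : (n : ℕ) → Emb (X n) (X (suc n))
  ιₑ n = emb (ιn T H n) record { cong = BHSystem.ι-cong (S n) ; mono = proj₂ (stage T H n) }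

  up-isOrderHomomorphism : ∀ {m n} (p : m ≤′ n) →
    IsOrderHomomorphism (Eq (X m)) (Eq (X n)) (Lt (X m)) (Lt (X n)) (up T H p)
  up-isOrderHomomorphism {m} ≤′-refl = isEmb (idE (X m))
  up-isOrderHomomorphism {m} {suc n} (≤′-step p) =
    isEmb (ιₑ n ∘E emb {X m} (up T H p) (up-isOrderHomomorphism p))

  upₑ : ∀ {m n} → m ≤′ n → Emb (X m) (X n)
  upₑ p = emb (up T H p) (up-isOrderHomomorphism p)

  up-trans : ∀ {m n k} (p : m ≤′ n) (q : n ≤′ k) x → up T H q (up T H p x) ≡ up T H (≤′-trans p q) x
  up-trans p ≤′-refl      x = refl
  up-trans {k = suc k} p (≤′-step q) x = cong (ιn T H k) (up-trans p q x)

  up-path : ∀ {m n k} (p : m ≤′ n) (q : n ≤′ k) (r : m ≤′ k) x → up T H q (up T H p x) ≡ up T H r x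
  up-path p q r x = ≡-trans (up-trans p q x) (cong (λ r → up T H r x) (≤′-irrelevant (≤′-trans p q) r))

  Point : Set
  Point = BHCar T H

  level : Point → ℕ
  level = proj₁

  at : ∀ {K} (a : Point) → level a ≤′ K → Car (X K)
  at (_ , x) p = up T H p x

  module _ {a b : Point} {K : ℕ} (pa : level a ≤′ K) (pb : level b ≤′ K) where
    private
      ⊔≤K : level a ⊔ level b ≤′ K
      ⊔≤K = ≤⇒≤′ (⊔-lub (≤′⇒≤ pa) (≤′⇒≤ pb))
      a↑ : up T H ⊔≤K (up T H (≤⇒≤′ (m≤m⊔n (level a) (level b))) (proj₂ a)) ≡ at a pa
      a↑ = up-path (≤⇒≤′ (m≤m⊔n (level a) (level b))) ⊔≤K pa (proj₂ a)
      b↑ : up T H ⊔≤K (up T H (≤⇒≤′ (m≤n⊔m (level a) (level b))) (proj₂ b)) ≡ at b pb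
      b↑ = up-path (≤⇒≤′ (m≤n⊔m (level a) (level b))) ⊔≤K pb (proj₂ b)

    <-at : BHLt T H a b → Lt (X K) (at a pa) (at b pb)
    <-at a<b = subst₂ (Lt (X K)) a↑ b↑ (IsOrderHomomorphism.mono (isEmb (upₑ ⊔≤K)) a<b)

    <-of-at : Lt (X K) (at a pa) (at b pb) → BHLt T H a b
    <-of-at a<b = emb-reflects-< (upₑ ⊔≤K) (subst₂ (Lt (X K)) (≡-sym a↑) (≡-sym b↑) a<b)

    ≈-at : BHEq T H a b → Eq (X K) (at a pa) (at b pb)
    ≈-at a≈b = subst₂ (Eq (X K)) a↑ b↑ (IsOrderHomomorphism.cong (isEmb (upₑ ⊔≤K)) a≈b)

    ≈-of-at : Eq (X K) (at a pa) (at b pb) → BHEq T H a b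
    ≈-of-at a≈b = emb-reflects-≈ (upₑ ⊔≤K) (subst₂ (Eq (X K)) (≡-sym a↑) (≡-sym b↑) a≈b)

  module _ {a b : Point} where
    private
      K : ℕ
      K = level a ⊔ level b
      pa : level a ≤′ K
      pa = ≤⇒≤′ (m≤m⊔n (level a) (level b))
      pb : level b ≤′ K
      pb = ≤⇒≤′ (m≤n⊔m (level a) (level b))

    BH-≈-sym : BHEq T H a b → BHEq T H b a
    BH-≈-sym a≈b = ≈-of-at pb pa (X.Eq.sym K a≈b)

    BH-compare : Tri (BHLt T H a b) (BHEq T H a b) (BHLt T H b a)
    BH-compare with X.compare K (at a pa) (at b pb)
    ... | tri< a<b a≉b b≮a = tri< a<b a≉b (b≮a ∘ <-at pb pa)
    ... | tri≈ a≮b a≈b b≮a = tri≈ a≮b a≈b (b≮a ∘ <-at pb pa)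
    ... | tri> a≮b a≉b b<a = tri> a≮b a≉b (<-of-at pb pa b<a)

  module _ {a b c : Point} where
    private
      K : ℕ
      K = level a ⊔ level b ⊔ level c
      pa : level a ≤′ K
      pa = ≤⇒≤′ (≤-trans (m≤m⊔n (level a) (level b)) (m≤m⊔n _ (level c)))
      pb : level b ≤′ K
      pb = ≤⇒≤′ (≤-trans (m≤n⊔m (level a) (level b)) (m≤m⊔n _ (level c)))
      pc : level c ≤′ K
      pc = ≤⇒≤′ (m≤n⊔m (level a ⊔ level b) (level c))

    BH-≈-trans : BHEq T H a b → BHEq T H b c → BHEq T H a c
    BH-≈-trans a≈b b≈c = ≈-of-at pa pc (X.Eq.trans K (≈-at pa pb a≈b) (≈-at pb pc b≈c))

    BH-<-trans : BHLt T H a b → BHLt T H b c → BHLt T H a c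
    BH-<-trans a<b b<c = <-of-at pa pc (X.trans K (<-at pa pb a<b) (<-at pb pc b<c))

    BH-<-respʳ-≈ : BHEq T H b c → BHLt T H a b → BHLt T H a c
    BH-<-respʳ-≈ b≈c a<b = <-of-at pa pc (X.<-respʳ-≈ K (≈-at pb pc b≈c) (<-at pa pb a<b))

    BH-<-respˡ-≈ : BHEq T H b c → BHLt T H b a → BHLt T H c a
    BH-<-respˡ-≈ b≈c b<a = <-of-at pc pa (X.<-respˡ-≈ K (≈-at pb pc b≈c) (<-at pb pa b<a))

  BH-isStrictTotalOrder : IsStrictTotalOrder (BHEq T H) (BHLt T H)
  BH-isStrictTotalOrder = record
    { isStrictPartialOrder = record
      { isEquivalence = record
        { refl  = λ {a} → ≈-of-at {a} {a} ≤′-refl ≤′-refl (X.Eq.refl (level a))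
        ; sym   = λ {a} {b} → BH-≈-sym {a} {b}
        ; trans = λ {a} {b} {c} → BH-≈-trans {a} {b} {c} }
      ; irrefl = λ {a} {b} → X.irrefl (level a ⊔ level b)
      ; trans = λ {a} {b} {c} → BH-<-trans {a} {b} {c}
      ; <-resp-≈ = (λ {a} {b} {c} → BH-<-respʳ-≈ {a} {b} {c}) , (λ {a} {b} {c} → BH-<-respˡ-≈ {a} {b} {c}) }
    ; compare = λ a b → BH-compare {a} {b} }

  B : LO
  B = BH T H BH-isStrictTotalOrder
  module B = StrictTotalOrder B
  module FB = StrictTotalOrder (F B)
  open import Relation.Binary.Reasoning.StrictPartialOrder B.strictPartialOrder

  jₑ : (K : ℕ) → Emb (X K) B
  jₑ K = emb (K ,_) record
    { cong = λ {x} {y} → ≈-of-at {K , x} {K , y} ≤′-refl ≤′-refl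
    ; mono = λ {x} {y} → <-of-at {K , x} {K , y} ≤′-refl ≤′-refl }

  up-≈ : ∀ {m N} (p : m ≤′ N) x → Eq B (N , up T H p x) (m , x)
  up-≈ {N = N} p x = ≈-of-at ≤′-refl p (X.Eq.refl N)

  levels : List Point → ℕ
  levels = maxL level

  lower : ∀ {a} l → Mem B a l → Σ (Car (X (levels l))) (λ y → Eq B (levels l , y) a)
  lower {a} l a∈ with Any.satisfied (all-any-∩ (maxL-bounds level l) a∈)
  ... | (m , x) , m≤ , a≈mx = up T H (≤⇒≤′ m≤) x , (begin-equality
    levels l , up T H (≤⇒≤′ m≤) x  ≈⟨ up-≈ (≤⇒≤′ m≤) x ⟩
    m , x                          ≈⟨ a≈mx ⟨
    a                              ∎)

  lowerₑ : (l : List Point) → Emb (Sub B l) (X (levels l))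
  lowerₑ l = emb (λ (a , a∈) → proj₁ (lower {a} l a∈)) record
    { cong = λ { {a , a∈} {a' , a'∈} a≈a' → emb-reflects-≈ (jₑ (levels l)) (begin-equality
        levels l , proj₁ (lower {a} l a∈)   ≈⟨ proj₂ (lower {a} l a∈) ⟩
        a                               ≈⟨ a≈a' ⟩
        a'                              ≈⟨ proj₂ (lower {a'} l a'∈) ⟨
        levels l , proj₁ (lower {a'} l a'∈) ∎) }
    ; mono = λ { {a , a∈} {a' , a'∈} a<a' → emb-reflects-< (jₑ (levels l)) (begin-strict
        levels l , proj₁ (lower {a} l a∈)   ≈⟨ proj₂ (lower {a} l a∈) ⟩
        a                               <⟨ a<a' ⟩
        a'                              ≈⟨ proj₂ (lower {a'} l a'∈) ⟨
        levels l , proj₁ (lower {a'} l a'∈) ∎) } }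

  Represents : Car (F B) → (K : ℕ) → Car (F (X K)) → Set
  Represents σ K ρ = Eq (F B) (fun (mor (jₑ K)) ρ) σ

  depth : Car (F B) → ℕ
  depth σ = levels (supp B σ)

  code : (σ : Car (F B)) → Car (F (X (depth σ)))
  code σ = fun (mor (lowerₑ (supp B σ))) (proj₁ (supp-rng B σ))

  code-represents : ∀ σ → Represents σ (depth σ) (code σ)
  code-represents σ = FB.Eq.trans (FB.Eq.sym (mor-∘ (jₑ (depth σ)) (lowerₑ (supp B σ)) σ₀))
    (FB.Eq.trans (mor-ext (jₑ (depth σ) ∘E lowerₑ (supp B σ)) (incl B (supp B σ)) (λ (a , a∈) → proj₂ (lower {a} _ a∈)) σ₀)
                 (proj₂ (supp-rng B σ)))
    where σ₀ = proj₁ (supp-rng B σ)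

  represents-up : ∀ {σ K K' ρ} → Represents σ K ρ → (p : K ≤′ K') → Represents σ K' (fun (mor (upₑ p)) ρ)
  represents-up {K = K} {K'} {ρ} rep p = FB.Eq.trans (FB.Eq.sym (mor-∘ (jₑ K') (upₑ p) ρ))
    (FB.Eq.trans (mor-ext (jₑ K' ∘E upₑ p) (jₑ K) (up-≈ p) ρ) rep)

  module _ {σ σ' K ρ ρ'} (rep : Represents σ K ρ) (rep' : Represents σ' K ρ') where
    represents-reflects-≈ : Eq (F B) σ σ' → Eq (F (X K)) ρ ρ'
    represents-reflects-≈ σ≈σ' = emb-reflects-≈ (mor (jₑ K)) (FB.Eq.trans rep (FB.Eq.trans σ≈σ' (FB.Eq.sym rep')))

    represents-reflects-< : Lt (F B) σ σ' → Lt (F (X K)) ρ ρ'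
    represents-reflects-< σ<σ' = emb-reflects-< (mor (jₑ K)) (FB.<-respˡ-≈ (FB.Eq.sym rep) (FB.<-respʳ-≈ (FB.Eq.sym rep') σ<σ'))

  module FX (n : ℕ) = StrictTotalOrder (F (X n))

  arg-up-ϑ : ∀ {K K'} (p : K ≤′ K') ρ →
             Eq (F (X K')) (arg (up T H (s≤′s p) (ϑ ρ))) (fun (mor (upₑ p)) ρ)
  arg-up-ϑ {K} ≤′-refl ρ = FX.Eq.sym K
    (FX.Eq.trans K (mor-ext (upₑ {K} ≤′-refl) (idE (X K)) (λ _ → X.Eq.refl K) ρ) (mor-id (X K) ρ))
  arg-up-ϑ {K} {suc K'} (≤′-step p) ρ =
    FX.Eq.trans (suc K') (IsOrderHomomorphism.cong (isEmb (mor (ιₑ K'))) (arg-up-ϑ p ρ))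
      (FX.Eq.trans (suc K') (FX.Eq.sym (suc K') (mor-∘ (ιₑ K') (upₑ p) ρ))
        (mor-ext (ιₑ K' ∘E upₑ p) (upₑ (≤′-step p)) (λ _ → X.Eq.refl (suc K')) ρ))

  ϑ-up-≈ : ∀ {K K'} (p : K ≤′ K') ρ → Eq B (suc K , ϑ ρ) (suc K' , ϑ (fun (mor (upₑ p)) ρ))
  ϑ-up-≈ {K} {K'} p ρ = ≈-of-at {suc K , ϑ ρ} {suc K' , _} (s≤′s p) ≤′-refl (arg-up-ϑ p ρ)

  θ : Car (F B) → Car B
  θ σ = suc (depth σ) , ϑ (code σ)

  module _ (σ : Car (F B)) {K : ℕ} (p : depth σ ≤′ K) where
    code↑ : Car (F (X K))
    code↑ = fun (mor (upₑ p)) (code σ)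

    code↑-represents : Represents σ K code↑
    code↑-represents = represents-up (code-represents σ) p

    θ-≈-code↑ : Eq B (θ σ) (suc K , ϑ code↑)
    θ-≈-code↑ = ϑ-up-≈ p (code σ)

  module _ {σ τ : Car (F B)} where
    private
      K : ℕ
      K = depth σ ⊔ depth τ
      pσ : depth σ ≤′ K
      pσ = ≤⇒≤′ (m≤m⊔n (depth σ) (depth τ))
      pτ : depth τ ≤′ K
      pτ = ≤⇒≤′ (m≤n⊔m (depth σ) (depth τ))

    θ-cong : Eq (F B) σ τ → Eq B (θ σ) (θ τ)
    θ-cong σ≈τ = begin-equality
      θ σ                       ≈⟨ θ-≈-code↑ σ pσ ⟩
      suc K , ϑ (code↑ σ pσ)    ≈⟨ IsOrderHomomorphism.cong (isEmb (jₑ (suc K)))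
                                     (represents-reflects-≈ (code↑-represents σ pσ) (code↑-represents τ pτ) σ≈τ) ⟩
      suc K , ϑ (code↑ τ pτ)    ≈⟨ θ-≈-code↑ τ pτ ⟨
      θ τ                       ∎

    θ-mono : Lt (F B) σ τ → LtFin B (supp B σ) (θ τ) → Lt B (θ σ) (θ τ)
    θ-mono σ<τ suppσ<θτ = begin-strict
      θ σ                       ≈⟨ θ-≈-code↑ σ pσ ⟩
      suc K , ϑ (code↑ σ pσ)    <⟨ IsOrderHomomorphism.mono (isEmb (jₑ (suc K))) ϑσ<ϑτ ⟩
      suc K , ϑ (code↑ τ pτ)    ≈⟨ θ-≈-code↑ τ pτ ⟨
      θ τ                       ∎
      where
        below : ∀ {x} → Mem (X K) x (supp (X K) (code↑ σ pσ)) →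
                Lt (X (suc K)) (ιn T H K x) (ϑ (code↑ τ pτ))
        below {x} x∈ = <-at {K , x} {suc K , ϑ (code↑ τ pτ)} (≤′-step ≤′-refl) ≤′-refl
                         (through (Any.satisfied (all-any-∩ suppσ<θτ x↑∈)))
          where
            x↑∈ : Mem B (K , x) (supp B σ)
            x↑∈ = SuppImage.supp-image⁺ T (jₑ K) (code↑-represents σ pσ) x∈
            through : Σ (Car B) (λ s → Lt B s (θ τ) × Eq B (K , x) s) →
                      Lt B (K , x) (suc K , ϑ (code↑ τ pτ))
            through (s , s<θτ , x≈s) = begin-strict
              K , x                    ≈⟨ x≈s ⟩
              s                        <⟨ s<θτ ⟩
              θ τ                      ≈⟨ θ-≈-code↑ τ pτ ⟩
              suc K , ϑ (code↑ τ pτ)   ∎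
        ϑσ<ϑτ : Lt (X (suc K)) (ϑ (code↑ σ pσ)) (ϑ (code↑ τ pτ))
        ϑσ<ϑτ = ϑOrder.ϑ<-fold (S K)
          (inj₁ (represents-reflects-< (code↑-represents σ pσ) (code↑-represents τ pτ) σ<τ ,
                 All.tabulateₛ (X.Eq.setoid K) below))

  θ-supp : ∀ σ → LtFin B (supp B σ) (θ σ)
  θ-supp σ = All.tabulateₛ B.Eq.setoid (λ {s} → below {s})
    where
      open import Data.List.Membership.Setoid (X.Eq.setoid (depth σ)) using (find)
      below : ∀ {s} → Mem B s (supp B σ) → Lt B s (θ σ)
      below {s} s∈ =
        through (find (SuppImage.supp-image⁻ T (jₑ (depth σ)) {z = s} (code-represents σ) s∈))
        where
          through : Σ (Car (X (depth σ)))
                      (λ x → Mem (X (depth σ)) x (supp (X (depth σ)) (code σ)) × Eq B s (depth σ , x)) →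
                    Lt B s (θ σ)
          through (x , x∈ , s≈x) = begin-strict
            s                  ≈⟨ s≈x ⟩
            depth σ , x        <⟨ <-of-at {depth σ , x} {θ σ} (≤′-step ≤′-refl) ≤′-refl
                                   (stage-suppBelowϑ (depth σ) (code σ) x (Any.map inj₂ x∈)) ⟩
            θ σ                ∎

theorem4p2 : (T : PraeDilator) →
    Σ (Facts T) (λ H →
    Σ (IsStrictTotalOrder (BHEq T H) (BHLt T H)) (λ lin →
    let B = BH T H lin
        TB = PraeDilator.F T B
        suppB = PraeDilator.supp T B
    in Σ (Car TB → Car B) (λ θ →
         (∀ {σ τ} → Eq TB σ τ → Eq B (θ σ) (θ τ))
       × (∀ σ τ → Lt TB σ τ → LtFin B (suppB σ) (θ τ) → Lt B (θ σ) (θ τ))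
       × (∀ σ → LtFin B (suppB σ) (θ σ)))))
theorem4p2 T = H , BH-isStrictTotalOrder , θ , θ-cong , (λ _ _ → θ-mono) , θ-supp
  where open Limit T
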